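{- (Odd case) Let $k\geq 3$ be odd, $\ell:=(k-1)/2$, and $a,b,c\in[k]$ with $a\neq b$ and $c\neq 1$. Then for each of the following sets of conditions there exist permutations $\pi=(\pi_1,\ldots,\pi_k)$ and $\rho=(\rho_1,\ldots,\rho_k)$ of $[k]$ satisfying it: (oa) $\pi_1=1$, $\rho_1=a$, $\rho_k=b$, and $\pi_{2j}\neq\rho_j$, $\pi_{2j+1}\neq\rho_{j+1}$ for all $1\leq j\leq\ell$; (ob1) $\pi_1=1$, $\pi_k=c$, $\rho_1=1$, $\pi_{2j}\neq\rho_j$ and $\pi_{2j+1}\neq\rho_{j+1}$ for all $1\leq j<\ell$, and $\pi_{k-1}\neq\rho_k$; (ob2) $\pi_1=1$, $\pi_2=c$, $\rho_1=1$, $\pi_3=\rho_k$, and $\pi_{2j}\neq\rho_j$, $\pi_{2j+1}\neq\rho_{j+1}$ for all $1\leq j\leq\ell$. (Even case) Let $k\geq 4$ be even, $\ell:=k/2$, and $a,b,c\in[k]$ with $a\neq b$ and $c\neq 1$. Then for each of the following sets of conditions there exist permutations $\pi,\rho$ of $[k]$ satisfying it: (ea) $\pi_1=1$, $\rho_1=a$, $\rho_k=b$, $\pi_3=\rho_{k-1}$, $\pi_{2j}\neq\rho_j$ and $\pi_{2j+1}\neq\rho_{j+1}$ for all $1\leq j<\ell$, and $\pi_k\neq\rho_k$; (eb1) $\pi_1=1$, $\pi_k=c$, $\rho_1=1$, $\pi_3=\rho_k$, and $\pi_{2j}\neq\rho_j$, $\pi_{2j+1}\neq\rho_{j+1}$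 for all $1\leq j<\ell$; (eb2) $\pi_1=1$, $\pi_k=c$, $\rho_1=1$, $\pi_{2j}\neq\rho_j$ and $\pi_{2j+1}\neq\rho_{j+1}$ for all $1\leq j<\ell$, and $\pi_k\neq\rho_k$.
   Context: $[k]:=\{1,\ldots,k\}$; a permutation of $[k]$ is written as a sequence $(\pi_1,\ldots,\pi_k)$ containing each element of $[k]$ exactly once. -}

module Defs where

open import Data.Nat using (ℕ; _≤_; suc)
open import Data.Product using (_×_; ∃)
open import Relation.Binary.PropositionalEquality using (_≡_)

-- A sequence (p 1, …, p k) given as a function ℕ → ℕ (1-indexed; values of p
-- outside [k] are irrelevant) is a permutation of [k] = {1,…,k} iff every
-- entry lies in [k] and each element of [k] occurs exactly once.
IsPerm : ℕ → (ℕ → ℕ) → Set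
IsPerm k p =
  (∀ i → 1 ≤ i → i ≤ k → 1 ≤ p i × p i ≤ k) ×
  (∀ v → 1 ≤ v → v ≤ k → ∃ λ i → 1 ≤ i × i ≤ k × p i ≡ v) ×
  (∀ i j → 1 ≤ i → i ≤ k → 1 ≤ j → j ≤ k → p i ≡ p j → i ≡ j)

{-# OPTIONS --safe #-}
module Submission where

-- Every condition compares entries of π and ρ with each other or with prescribed values, so
-- composing both with one bijection σ of [k] keeps all the inequalities and moves the prescribed
-- values wherever σ sends them.  Each case is thus reduced to a base pair (π₀, ρ₀), built from at
-- most three transpositions, with the right coincidences among the prescribed entries.  Since π₀
-- is the identity from position 4 on and ρ₀ from position 3 up to the middle, the constraints for
-- j ≥ 2 reduce to 2j ≠ j and 2j + 1 ≠ j + 1, and only j = 1 and j = 2 need checking.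

open import Defs
open import Data.Nat using (ℕ; suc; _+_; _*_; _≤_; _<_; _∸_; z≤n; s≤s; z<s)
open import Data.Nat.Properties
open import Data.Product using (_×_; ∃; ∃₂; _,_)
open import Function using (_∘_; id; _∋_)
open import Function.Definitions using (Injective)
open import Relation.Nullary using (yes; no; contradiction)
open import Relation.Binary.PropositionalEquality
  using (_≡_; _≢_; refl; sym; trans; cong; subst; ≢-sym; module ≡-Reasoning)

n<2*n : ∀ {n} → 1 ≤ n → n < 2 * n
n<2*n {n} 1≤n = m<m+n n (≤-trans 1≤n (m≤m+n n 0))

n+1<2*n+1 : ∀ {n} → 1 ≤ n → n + 1 < 2 * n + 1
n+1<2*n+1 1≤n = +-monoˡ-< 1 (n<2*n 1≤n)

m<n⇒2*m+1<2*n : ∀ {m n} → m < n → 2 * m + 1 < 2 * n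
m<n⇒2*m+1<2*n {m} {n} m<n = begin-strict
  2 * m + 1    ≡⟨ +-comm (2 * m) 1 ⟩
  suc (2 * m)  <⟨ n<1+n (suc (2 * m)) ⟩
  2 + 2 * m    ≡⟨ *-suc 2 m ⟨
  2 * suc m    ≤⟨ *-monoʳ-≤ 2 m<n ⟩
  2 * n        ∎
  where open ≤-Reasoning

m≤n⇒m+n≤2*n : ∀ {m n} → m ≤ n → m + n ≤ 2 * n
m≤n⇒m+n≤2*n {m} {n} m≤n = begin
  m + n        ≤⟨ +-monoˡ-≤ n m≤n ⟩
  n + n        ≡⟨ cong (n +_) (+-identityʳ n) ⟨
  2 * n        ∎
  where open ≤-Reasoning

n∸1<n : ∀ {n} → 1 ≤ n → n ∸ 1 < n
n∸1<n {suc n} _ = n<1+n n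

_∈[1,_] : ℕ → ℕ → Set
x ∈[1, k ] = 1 ≤ x × x ≤ k

transpose : ℕ → ℕ → ℕ → ℕ
transpose x y v with v ≟ x | v ≟ y
... | yes _ | _     = y
... | no _  | yes _ = x
... | no _  | no _  = v

transpose-left : ∀ x y → transpose x y x ≡ y
transpose-left x y with x ≟ x | x ≟ y
... | yes _   | _ = refl
... | no x≢x  | _ = contradiction refl x≢x

transpose-right : ∀ x y → transpose x y y ≡ x
transpose-right x y with y ≟ x | y ≟ y
... | yes y≡x | _       = y≡x
... | no _    | yes _   = refl
... | no _    | no y≢y  = contradiction refl y≢y

transpose-other : ∀ x y {v} → v ≢ x → v ≢ y → transpose x y v ≡ v
transpose-other x y {v} v≢x v≢y with v ≟ x | v ≟ y
... | yes v≡x | _       = contradiction v≡x v≢x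
... | no _    | yes v≡y = contradiction v≡y v≢y
... | no _    | no _    = refl

transpose-involutive : ∀ x y v → transpose x y (transpose x y v) ≡ v
transpose-involutive x y v with v ≟ x | v ≟ y
... | yes refl | _        = transpose-right v y
... | no _     | yes refl = transpose-left x v
... | no v≢x   | no v≢y   = transpose-other x y v≢x v≢y

transpose-∈ : ∀ {k x y v} → x ∈[1, k ] → y ∈[1, k ] → v ∈[1, k ] → transpose x y v ∈[1, k ]
transpose-∈ {x = x} {y} {v} x∈ y∈ v∈ with v ≟ x | v ≟ y
... | yes _ | _     = y∈
... | no _  | yes _ = x∈
... | no _  | no _  = v∈

involution-injective : ∀ {f : ℕ → ℕ} → (∀ v → f (f v) ≡ v) → Injective _≡_ _≡_ f
involution-injective {f} f∘f≡id {u} {v} fu≡fv = begin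
  u       ≡⟨ sym (f∘f≡id u) ⟩
  f (f u) ≡⟨ cong f fu≡fv ⟩
  f (f v) ≡⟨ f∘f≡id v ⟩
  v       ∎
  where open ≡-Reasoning

involution-isPerm : ∀ {k f} → (∀ {v} → v ∈[1, k ] → f v ∈[1, k ]) → (∀ v → f (f v) ≡ v) →
                    IsPerm k f
involution-isPerm {f = f} f∈ f∘f≡id =
  (λ i 1≤i i≤k → f∈ (1≤i , i≤k)) ,
  (λ v 1≤v v≤k → let (1≤fv , fv≤k) = f∈ (1≤v , v≤k) in f v , 1≤fv , fv≤k , f∘f≡id v) ,
  (λ i j _ _ _ _ → involution-injective f∘f≡id)

transpose-isPerm : ∀ {k x y} → x ∈[1, k ] → y ∈[1, k ] → IsPerm k (transpose x y)
transpose-isPerm {x = x} {y} x∈ y∈ =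
  involution-isPerm (transpose-∈ x∈ y∈) (transpose-involutive x y)

∘-isPerm : ∀ {k σ p} → IsPerm k σ → IsPerm k p → IsPerm k (σ ∘ p)
∘-isPerm {σ = σ} {p} (σ-∈ , σ-onto , σ-inj) (p-∈ , p-onto , p-inj) =
  (λ i 1≤i i≤k → let (1≤pi , pi≤k) = p-∈ i 1≤i i≤k in σ-∈ (p i) 1≤pi pi≤k) ,
  (λ v 1≤v v≤k → let (i , 1≤i , i≤k , σi≡v) = σ-onto v 1≤v v≤k
                     (j , 1≤j , j≤k , pj≡i) = p-onto i 1≤i i≤k
                 in j , 1≤j , j≤k , trans (cong σ pj≡i) σi≡v) ,
  (λ i j 1≤i i≤k 1≤j j≤k σpi≡σpj →
     let (1≤pi , pi≤k) = p-∈ i 1≤i i≤k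
         (1≤pj , pj≤k) = p-∈ j 1≤j j≤k
     in p-inj i j 1≤i i≤k 1≤j j≤k (σ-inj (p i) (p j) 1≤pi pi≤k 1≤pj pj≤k σpi≡σpj))

Relabeling : ℕ → (ℕ → ℕ) → Set
Relabeling k σ = IsPerm k σ × Injective _≡_ _≡_ σ

transpose-relabeling : ∀ {k x y} → x ∈[1, k ] → y ∈[1, k ] → Relabeling k (transpose x y)
transpose-relabeling {x = x} {y} x∈ y∈ =
  transpose-isPerm x∈ y∈ , involution-injective (transpose-involutive x y)

∘-relabeling : ∀ {k σ τ} → Relabeling k σ → Relabeling k τ → Relabeling k (σ ∘ τ)
∘-relabeling (σ-perm , σ-inj) (τ-perm , τ-inj) = ∘-isPerm σ-perm τ-perm , τ-inj ∘ σ-inj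

relabel₁ : ∀ {k x a} → x ∈[1, k ] → a ∈[1, k ] → x ≢ 1 → a ≢ 1 →
           ∃ λ σ → Relabeling k σ × σ 1 ≡ 1 × σ x ≡ a
relabel₁ {x = x} {a} x∈ a∈ x≢1 a≢1 =
  transpose x a , transpose-relabeling x∈ a∈ ,
  transpose-other x a (≢-sym x≢1) (≢-sym a≢1) , transpose-left x a

relabel₂ : ∀ {k x y a b} → x ∈[1, k ] → y ∈[1, k ] → a ∈[1, k ] → b ∈[1, k ] →
           x ≢ 1 → y ≢ 1 → a ≢ 1 → b ≢ 1 → x ≢ y → a ≢ b →
           ∃ λ σ → Relabeling k σ × σ 1 ≡ 1 × σ x ≡ a × σ y ≡ b
relabel₂ {k} {x} {y} {a} {b} x∈ y∈ a∈ b∈ x≢1 y≢1 a≢1 b≢1 x≢y a≢b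
  with relabel₁ x∈ a∈ x≢1 a≢1
... | τ , τ-rel@(τ-perm , τ-inj) , τ1≡1 , τx≡a =
  transpose (τ y) b ∘ τ , ∘-relabeling (transpose-relabeling τy∈ b∈) τ-rel ,
  trans (cong (transpose (τ y) b) τ1≡1) (transpose-other (τ y) b 1≢τy (≢-sym b≢1)) ,
  trans (cong (transpose (τ y) b) τx≡a) (transpose-other (τ y) b a≢τy a≢b) ,
  transpose-left (τ y) b
  where
  τy∈ : τ y ∈[1, k ]
  τy∈ = let (τ-∈ , _) = τ-perm ; (1≤y , y≤k) = y∈ in τ-∈ y 1≤y y≤k
  1≢τy : 1 ≢ τ y
  1≢τy 1≡τy = y≢1 (sym (τ-inj (trans τ1≡1 1≡τy)))
  a≢τy : a ≢ τ y
  a≢τy a≡τy = x≢y (τ-inj (trans τx≡a a≡τy))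

Separated : (ℕ → Set) → (ℕ → ℕ) → (ℕ → ℕ) → Set
Separated J π ρ = ∀ j → 1 ≤ j → J j → π (2 * j) ≢ ρ j × π (2 * j + 1) ≢ ρ (j + 1)

relabel-separated : ∀ {J σ} π ρ → Injective _≡_ _≡_ σ → Separated J π ρ →
                    Separated J (σ ∘ π) (σ ∘ ρ)
relabel-separated _ _ σ-inj sep j 1≤j Jj =
  let (π≢ρ , π≢ρ′) = sep j 1≤j Jj in π≢ρ ∘ σ-inj , π≢ρ′ ∘ σ-inj

id-separated : ∀ {J} → Separated J id id
id-separated j 1≤j _ = >⇒≢ (n<2*n 1≤j) , >⇒≢ (n+1<2*n+1 1≤j)

separated-fixed : ∀ {J : ℕ → Set} {m π ρ} → (∀ {j} → J j → j < m) →
                  π 2 ≢ ρ 1 → π 3 ≢ ρ 2 → (J 2 → 4 ≢ ρ 2) →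
                  (∀ {i} → 4 ≤ i → i < 2 * m → π i ≡ i) →
                  (∀ {i} → 3 ≤ i → i ≤ m → ρ i ≡ i) →
                  Separated J π ρ
separated-fixed {J} {m} {π} {ρ} below π2≢ρ1 π3≢ρ2 4≢ρ2 π-fixed ρ-fixed j 1≤j Jj =
  even-position j 1≤j Jj , odd-position j 1≤j Jj
  where
  2*j+1<2*m : ∀ {j} → J j → 2 * j + 1 < 2 * m
  2*j+1<2*m Jj = m<n⇒2*m+1<2*n (below Jj)
  2*j<2*m : ∀ {j} → J j → 2 * j < 2 * m
  2*j<2*m {j} Jj = <-trans (m<m+n (2 * j) z<s) (2*j+1<2*m Jj)
  4≤2*j : ∀ {j} → 2 ≤ j → 4 ≤ 2 * j
  4≤2*j = *-monoʳ-≤ 2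

  even-position : ∀ j → 1 ≤ j → J j → π (2 * j) ≢ ρ j
  even-position 1 _ _ = π2≢ρ1
  even-position 2 _ J2 π4≡ρ2 = 4≢ρ2 J2 (trans (sym (π-fixed ≤-refl (2*j<2*m J2))) π4≡ρ2)
  even-position j@(suc (suc (suc _))) 1≤j Jj π2j≡ρj =
    >⇒≢ (n<2*n 1≤j) (begin
      2 * j      ≡⟨ π-fixed (4≤2*j {j} (s≤s (s≤s z≤n))) (2*j<2*m Jj) ⟨
      π (2 * j)  ≡⟨ π2j≡ρj ⟩
      ρ j        ≡⟨ ρ-fixed (s≤s (s≤s (s≤s z≤n))) (<⇒≤ (below Jj)) ⟩
      j          ∎)
    where open ≡-Reasoning

  odd-position : ∀ j → 1 ≤ j → J j → π (2 * j + 1) ≢ ρ (j + 1)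
  odd-position 1 _ _ = π3≢ρ2
  odd-position j@(suc (suc _)) 1≤j Jj π2j+1≡ρj+1 =
    >⇒≢ (n+1<2*n+1 1≤j) (begin
      2 * j + 1      ≡⟨ π-fixed 4≤2*j+1 (2*j+1<2*m Jj) ⟨
      π (2 * j + 1)  ≡⟨ π2j+1≡ρj+1 ⟩
      ρ (j + 1)      ≡⟨ ρ-fixed (+-monoˡ-≤ 1 (s≤s (s≤s z≤n))) j+1≤m ⟩
      j + 1          ∎)
    where
    open ≡-Reasoning
    4≤2*j+1 : 4 ≤ 2 * j + 1
    4≤2*j+1 = ≤-trans (4≤2*j {j} (s≤s (s≤s z≤n))) (m≤m+n (2 * j) 1)
    j+1≤m : j + 1 ≤ m
    j+1≤m = ≤-trans (≤-reflexive (+-comm j 1)) (below Jj)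

transpose-2-3-fixed : ∀ {i} → 4 ≤ i → transpose 2 3 i ≡ i
transpose-2-3-fixed 4≤i = transpose-other 2 3 (>⇒≢ (≤-trans (n≤1+n 3) 4≤i)) (>⇒≢ 4≤i)

transpose-23-2k-separated : ∀ {J k m} → 2 < k → (∀ {j} → J j → j < m) → (J 2 → 4 < k) →
                    (∀ {i} → i ≤ m → i < k) → Separated J (transpose 2 3) (transpose 2 k)
transpose-23-2k-separated {k = k} 2<k below 4<k below-k =
  separated-fixed below
    (λ 3≡ρ1 → (3 ≢ 1 ∋ λ ()) (trans 3≡ρ1 ρ1≡1))
    (λ 2≡ρ2 → <⇒≢ 2<k (trans 2≡ρ2 ρ2≡k))
    (λ J2 4≡ρ2 → <⇒≢ (4<k J2) (trans 4≡ρ2 ρ2≡k))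
    (λ 4≤i _ → transpose-2-3-fixed 4≤i)
    (λ 3≤i i≤m → transpose-other 2 k (>⇒≢ 3≤i) (<⇒≢ (below-k i≤m)))
  where
  ρ1≡1 : transpose 2 k 1 ≡ 1
  ρ1≡1 = transpose-other 2 k (λ ()) (<⇒≢ (≤-trans (n≤1+n 2) 2<k))
  ρ2≡k : transpose 2 k 2 ≡ k
  ρ2≡k = transpose-left 2 k

module OddCase (k ℓ : ℕ) (3≤k : 3 ≤ k) (k≡2*ℓ+1 : k ≡ 2 * ℓ + 1) where

  k≡1+2*ℓ : k ≡ suc (2 * ℓ)
  k≡1+2*ℓ = trans k≡2*ℓ+1 (+-comm (2 * ℓ) 1)

  1≤ℓ : 1 ≤ ℓ
  1≤ℓ = *-cancelˡ-≤ 2 (≤-pred (subst (3 ≤_) k≡1+2*ℓ 3≤k))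

  below-k : ∀ {i} → i ≤ suc ℓ → i < k
  below-k i≤1+ℓ = subst (_ <_) (sym k≡1+2*ℓ) (s≤s (≤-trans i≤1+ℓ (n<2*n 1≤ℓ)))

  4<k : 2 ≤ ℓ → 4 < k
  4<k 2≤ℓ = subst (4 <_) (sym k≡1+2*ℓ) (s≤s (*-monoʳ-≤ 2 2≤ℓ))

  1<k : 1 < k
  1<k = ≤-trans (n≤1+n 2) 3≤k

  k≢1 : k ≢ 1
  k≢1 = >⇒≢ 1<k

  1∈ : 1 ∈[1, k ]
  1∈ = ≤-refl , <⇒≤ 1<k
  2∈ : 2 ∈[1, k ]
  2∈ = s≤s z≤n , <⇒≤ 3≤k
  3∈ : 3 ∈[1, k ]
  3∈ = s≤s z≤n , 3≤k
  k∈ : k ∈[1, k ]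
  k∈ = <⇒≤ 1<k , ≤-refl

  interior : ∀ {i} → 3 ≤ i → i ≤ suc ℓ → i ≢ 1 × i ≢ 2 × i ≢ k
  interior 3≤i i≤1+ℓ = >⇒≢ (≤-trans (n≤1+n 2) 3≤i) , >⇒≢ 3≤i , <⇒≢ (below-k i≤1+ℓ)

  Oa : ℕ → ℕ → Set
  Oa a b = ∃₂ λ π ρ → IsPerm k π × IsPerm k ρ × π 1 ≡ 1 × ρ 1 ≡ a × ρ k ≡ b × Separated (_≤ ℓ) π ρ

  oa-starting-at-1 : ∀ {b} → b ∈[1, k ] → b ≢ 1 → Oa 1 b
  oa-starting-at-1 b∈ b≢1 =
    let (σ , (σ-perm , σ-inj) , σ1≡1 , σk≡b) = relabel₁ k∈ b∈ k≢1 b≢1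
    in σ , σ , σ-perm , σ-perm , σ1≡1 , σ1≡1 , σk≡b , relabel-separated id id σ-inj id-separated

  oa-ending-at-1 : ∀ {a} → a ∈[1, k ] → a ≢ 1 → Oa a 1
  oa-ending-at-1 a∈ a≢1 =
    let (σ , (σ-perm , σ-inj) , σ1≡1 , σk≡a) = relabel₁ k∈ a∈ k≢1 a≢1
    in σ , σ ∘ transpose 1 k , σ-perm , ∘-isPerm σ-perm (transpose-isPerm 1∈ k∈) ,
       σ1≡1 , trans (cong σ (transpose-left 1 k)) σk≡a , trans (cong σ (transpose-right 1 k)) σ1≡1 ,
       relabel-separated id (transpose 1 k) σ-inj separated
    where
    ρ2≡2 : transpose 1 k 2 ≡ 2
    ρ2≡2 = transpose-other 1 k (λ ()) (<⇒≢ 3≤k)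
    separated : Separated (_≤ ℓ) id (transpose 1 k)
    separated = separated-fixed s≤s
      (λ 2≡ρ1 → <⇒≢ 3≤k (trans 2≡ρ1 (transpose-left 1 k)))
      (λ 3≡ρ2 → (3 ≢ 2 ∋ λ ()) (trans 3≡ρ2 ρ2≡2))
      (λ _ 4≡ρ2 → (4 ≢ 2 ∋ λ ()) (trans 4≡ρ2 ρ2≡2))
      (λ _ _ → refl)
      (λ 3≤i i≤1+ℓ → let (i≢1 , _ , i≢k) = interior 3≤i i≤1+ℓ in transpose-other 1 k i≢1 i≢k)

  oa-avoiding-1 : ∀ {a b} → a ∈[1, k ] → b ∈[1, k ] → a ≢ 1 → b ≢ 1 → a ≢ b → Oa a b
  oa-avoiding-1 a∈ b∈ a≢1 b≢1 a≢b =
    let (σ , (σ-perm , σ-inj) , σ1≡1 , σk≡a , σ2≡b) =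
          relabel₂ k∈ 2∈ a∈ b∈ k≢1 (λ ()) a≢1 b≢1 (>⇒≢ 3≤k) a≢b
    in σ , σ ∘ ρ₀ , σ-perm , ∘-isPerm σ-perm (∘-isPerm (transpose-isPerm 1∈ 2∈) (transpose-isPerm 1∈ k∈)) ,
       σ1≡1 , trans (cong σ ρ₀1≡k) σk≡a , trans (cong σ ρ₀k≡2) σ2≡b ,
       relabel-separated id ρ₀ σ-inj separated
    where
    ρ₀ : ℕ → ℕ
    ρ₀ = transpose 1 2 ∘ transpose 1 k
    ρ₀1≡k : ρ₀ 1 ≡ k
    ρ₀1≡k = trans (cong (transpose 1 2) (transpose-left 1 k)) (transpose-other 1 2 k≢1 (>⇒≢ 3≤k))
    ρ₀k≡2 : ρ₀ k ≡ 2
    ρ₀k≡2 = cong (transpose 1 2) (transpose-right 1 k)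
    ρ₀2≡1 : ρ₀ 2 ≡ 1
    ρ₀2≡1 = cong (transpose 1 2) (transpose-other 1 k (λ ()) (<⇒≢ 3≤k))
    separated : Separated (_≤ ℓ) id ρ₀
    separated = separated-fixed s≤s
      (λ 2≡ρ1 → <⇒≢ 3≤k (trans 2≡ρ1 ρ₀1≡k))
      (λ 3≡ρ2 → (3 ≢ 1 ∋ λ ()) (trans 3≡ρ2 ρ₀2≡1))
      (λ _ 4≡ρ2 → (4 ≢ 1 ∋ λ ()) (trans 4≡ρ2 ρ₀2≡1))
      (λ _ _ → refl)
      (λ 3≤i i≤1+ℓ → let (i≢1 , i≢2 , i≢k) = interior 3≤i i≤1+ℓ
                     in trans (cong (transpose 1 2) (transpose-other 1 k i≢1 i≢k)) (transpose-other 1 2 i≢1 i≢2))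

  oa : ∀ {a b} → a ∈[1, k ] → b ∈[1, k ] → a ≢ b → Oa a b
  oa {a} {b} a∈ b∈ a≢b with a ≟ 1 | b ≟ 1
  ... | yes refl | yes refl = contradiction refl a≢b
  ... | yes refl | no b≢1   = oa-starting-at-1 b∈ b≢1
  ... | no a≢1   | yes refl = oa-ending-at-1 a∈ a≢1
  ... | no a≢1   | no b≢1   = oa-avoiding-1 a∈ b∈ a≢1 b≢1 a≢b

  Ob1 : ℕ → Set
  Ob1 c = ∃₂ λ π ρ → IsPerm k π × IsPerm k ρ × π 1 ≡ 1 × π k ≡ c × ρ 1 ≡ 1 ×
                     Separated (_< ℓ) π ρ × π (k ∸ 1) ≢ ρ k

  ob1 : ∀ {c} → c ∈[1, k ] → c ≢ 1 → Ob1 c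
  ob1 c∈ c≢1 =
    let (σ , (σ-perm , σ-inj) , σ1≡1 , σk≡c) = relabel₁ k∈ c∈ k≢1 c≢1
    in σ , σ , σ-perm , σ-perm , σ1≡1 , σk≡c , σ1≡1 , relabel-separated id id σ-inj id-separated ,
       <⇒≢ (n∸1<n (<⇒≤ 1<k)) ∘ σ-inj

  Ob2 : ℕ → Set
  Ob2 c = ∃₂ λ π ρ → IsPerm k π × IsPerm k ρ × π 1 ≡ 1 × π 2 ≡ c × ρ 1 ≡ 1 × π 3 ≡ ρ k ×
                     Separated (_≤ ℓ) π ρ

  ob2 : ∀ {c} → c ∈[1, k ] → c ≢ 1 → Ob2 c
  ob2 c∈ c≢1 =
    let (σ , (σ-perm , σ-inj) , σ1≡1 , σ3≡c) = relabel₁ 3∈ c∈ (λ ()) c≢1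
    in σ ∘ transpose 2 3 , σ ∘ transpose 2 k ,
       ∘-isPerm σ-perm (transpose-isPerm 2∈ 3∈) , ∘-isPerm σ-perm (transpose-isPerm 2∈ k∈) ,
       σ1≡1 , σ3≡c , trans (cong σ (transpose-other 2 k (λ ()) (<⇒≢ 1<k))) σ1≡1 ,
       cong σ (sym (transpose-right 2 k)) ,
       relabel-separated (transpose 2 3) (transpose 2 k) σ-inj (transpose-23-2k-separated 3≤k s≤s 4<k below-k)

module EvenCase (k ℓ : ℕ) (4≤k : 4 ≤ k) (k≡2*ℓ : k ≡ 2 * ℓ) where

  2≤ℓ : 2 ≤ ℓ
  2≤ℓ = *-cancelˡ-≤ 2 (subst (4 ≤_) k≡2*ℓ 4≤k)

  below-k∸1 : ∀ {i} → i ≤ ℓ → i < k ∸ 1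
  below-k∸1 i≤ℓ = suc[m]≤n⇒m≤pred[n]
    (subst (_ ≤_) (sym k≡2*ℓ) (≤-trans (+-monoʳ-≤ 2 i≤ℓ) (m≤n⇒m+n≤2*n 2≤ℓ)))

  5<k : 2 < ℓ → 5 < k
  5<k 3≤ℓ = subst (5 <_) (sym k≡2*ℓ) (*-monoʳ-≤ 2 3≤ℓ)

  2<k : 2 < k
  2<k = ≤-trans (n≤1+n 3) 4≤k
  1<k : 1 < k
  1<k = ≤-trans (n≤1+n 2) 2<k
  k∸1<k : k ∸ 1 < k
  k∸1<k = n∸1<n (<⇒≤ 1<k)
  3≤k∸1 : 3 ≤ k ∸ 1
  3≤k∸1 = suc[m]≤n⇒m≤pred[n] 4≤k

  1∈ : 1 ∈[1, k ]
  1∈ = ≤-refl , <⇒≤ 1<k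
  2∈ : 2 ∈[1, k ]
  2∈ = s≤s z≤n , ≤-trans (n≤1+n 2) (<⇒≤ 4≤k)
  3∈ : 3 ∈[1, k ]
  3∈ = s≤s z≤n , <⇒≤ 4≤k
  k∸1∈ : (k ∸ 1) ∈[1, k ]
  k∸1∈ = ≤-trans (s≤s z≤n) 3≤k∸1 , <⇒≤ k∸1<k
  k∈ : k ∈[1, k ]
  k∈ = <⇒≤ 1<k , ≤-refl

  k≢1 : k ≢ 1
  k≢1 = >⇒≢ 1<k
  k∸1≢1 : k ∸ 1 ≢ 1
  k∸1≢1 = >⇒≢ (≤-trans (n≤1+n 2) 3≤k∸1)
  k∸1≢2 : k ∸ 1 ≢ 2
  k∸1≢2 = >⇒≢ 3≤k∸1
  k≢2 : k ≢ 2
  k≢2 = >⇒≢ 2<k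
  k≢k∸1 : k ≢ k ∸ 1
  k≢k∸1 = >⇒≢ k∸1<k

  interior : ∀ {i} → 3 ≤ i → i ≤ ℓ → i ≢ 1 × i ≢ 2 × i ≢ k ∸ 1 × i ≢ k
  interior 3≤i i≤ℓ =
    >⇒≢ (≤-trans (n≤1+n 2) 3≤i) , >⇒≢ 3≤i , <⇒≢ (below-k∸1 i≤ℓ) , <⇒≢ (<-trans (below-k∸1 i≤ℓ) k∸1<k)

  t23k≡k : transpose 2 3 k ≡ k
  t23k≡k = transpose-2-3-fixed 4≤k

  Ea : ℕ → ℕ → Set
  Ea a b = ∃₂ λ π ρ → IsPerm k π × IsPerm k ρ × π 1 ≡ 1 × ρ 1 ≡ a × ρ k ≡ b × π 3 ≡ ρ (k ∸ 1) ×
                      Separated (_< ℓ) π ρ × π k ≢ ρ k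

  ea-starting-at-1 : ∀ {b} → b ∈[1, k ] → b ≢ 1 → Ea 1 b
  ea-starting-at-1 b∈ b≢1 =
    let (σ , (σ-perm , σ-inj) , σ1≡1 , σk∸1≡b) = relabel₁ k∸1∈ b∈ k∸1≢1 b≢1
    in σ ∘ transpose 2 3 , σ ∘ ρ₀ ,
       ∘-isPerm σ-perm (transpose-isPerm 2∈ 3∈) ,
       ∘-isPerm σ-perm (∘-isPerm (transpose-isPerm 2∈ k∸1∈) (transpose-isPerm 2∈ k∈)) ,
       σ1≡1 , trans (cong σ ρ₀1≡1) σ1≡1 , trans (cong σ ρ₀k≡k∸1) σk∸1≡b , cong σ (sym ρ₀k∸1≡2) ,
       relabel-separated (transpose 2 3) ρ₀ σ-inj separated ,
       λ σk≡σρ₀k → k≢k∸1 (trans (sym t23k≡k) (trans (σ-inj σk≡σρ₀k) ρ₀k≡k∸1))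
    where
    ρ₀ : ℕ → ℕ
    ρ₀ = transpose 2 (k ∸ 1) ∘ transpose 2 k
    ρ₀1≡1 : ρ₀ 1 ≡ 1
    ρ₀1≡1 = trans (cong (transpose 2 (k ∸ 1)) (transpose-other 2 k (λ ()) (<⇒≢ 1<k)))
                  (transpose-other 2 (k ∸ 1) (λ ()) (≢-sym k∸1≢1))
    ρ₀2≡k : ρ₀ 2 ≡ k
    ρ₀2≡k = trans (cong (transpose 2 (k ∸ 1)) (transpose-left 2 k))
                  (transpose-other 2 (k ∸ 1) (>⇒≢ 2<k) k≢k∸1)
    ρ₀k≡k∸1 : ρ₀ k ≡ k ∸ 1
    ρ₀k≡k∸1 = trans (cong (transpose 2 (k ∸ 1)) (transpose-right 2 k)) (transpose-left 2 (k ∸ 1))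
    ρ₀k∸1≡2 : ρ₀ (k ∸ 1) ≡ 2
    ρ₀k∸1≡2 = trans (cong (transpose 2 (k ∸ 1)) (transpose-other 2 k k∸1≢2 (≢-sym k≢k∸1)))
                    (transpose-right 2 (k ∸ 1))
    separated : Separated (_< ℓ) (transpose 2 3) ρ₀
    separated = separated-fixed id
      (λ 3≡ρ1 → (3 ≢ 1 ∋ λ ()) (trans 3≡ρ1 ρ₀1≡1))
      (λ 2≡ρ2 → <⇒≢ 2<k (trans 2≡ρ2 ρ₀2≡k))
      (λ 2<ℓ 4≡ρ2 → <⇒≢ (<-trans (n<1+n 4) (5<k 2<ℓ)) (trans 4≡ρ2 ρ₀2≡k))
      (λ 4≤i _ → transpose-2-3-fixed 4≤i)
      (λ 3≤i i≤ℓ → let (_ , i≢2 , i≢k∸1 , i≢k) = interior 3≤i i≤ℓ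
                   in trans (cong (transpose 2 (k ∸ 1)) (transpose-other 2 k i≢2 i≢k))
                            (transpose-other 2 (k ∸ 1) i≢2 i≢k∸1))

  ea-ending-at-1 : ∀ {a} → a ∈[1, k ] → a ≢ 1 → Ea a 1
  ea-ending-at-1 a∈ a≢1 =
    let (σ , (σ-perm , σ-inj) , σ1≡1 , σk≡a) = relabel₁ k∈ a∈ k≢1 a≢1
    in σ ∘ transpose 2 3 , σ ∘ ρ₀ ,
       ∘-isPerm σ-perm (transpose-isPerm 2∈ 3∈) ,
       ∘-isPerm σ-perm (∘-isPerm (transpose-isPerm 1∈ k∈) (transpose-isPerm 2∈ k∸1∈)) ,
       σ1≡1 , trans (cong σ ρ₀1≡k) σk≡a , trans (cong σ ρ₀k≡1) σ1≡1 , cong σ (sym ρ₀k∸1≡2) ,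
       relabel-separated (transpose 2 3) ρ₀ σ-inj separated ,
       λ σk≡σρ₀k → k≢1 (trans (sym t23k≡k) (trans (σ-inj σk≡σρ₀k) ρ₀k≡1))
    where
    ρ₀ : ℕ → ℕ
    ρ₀ = transpose 1 k ∘ transpose 2 (k ∸ 1)
    ρ₀1≡k : ρ₀ 1 ≡ k
    ρ₀1≡k = trans (cong (transpose 1 k) (transpose-other 2 (k ∸ 1) (λ ()) (≢-sym k∸1≢1)))
                  (transpose-left 1 k)
    ρ₀2≡k∸1 : ρ₀ 2 ≡ k ∸ 1
    ρ₀2≡k∸1 = trans (cong (transpose 1 k) (transpose-left 2 (k ∸ 1)))
                    (transpose-other 1 k k∸1≢1 (≢-sym k≢k∸1))
    ρ₀k≡1 : ρ₀ k ≡ 1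
    ρ₀k≡1 = trans (cong (transpose 1 k) (transpose-other 2 (k ∸ 1) k≢2 k≢k∸1)) (transpose-right 1 k)
    ρ₀k∸1≡2 : ρ₀ (k ∸ 1) ≡ 2
    ρ₀k∸1≡2 = trans (cong (transpose 1 k) (transpose-right 2 (k ∸ 1)))
                    (transpose-other 1 k (λ ()) (<⇒≢ 2<k))
    separated : Separated (_< ℓ) (transpose 2 3) ρ₀
    separated = separated-fixed id
      (λ 3≡ρ1 → <⇒≢ 4≤k (trans 3≡ρ1 ρ₀1≡k))
      (λ 2≡ρ2 → <⇒≢ 3≤k∸1 (trans 2≡ρ2 ρ₀2≡k∸1))
      (λ 2<ℓ 4≡ρ2 → <⇒≢ (suc[m]≤n⇒m≤pred[n] (5<k 2<ℓ)) (trans 4≡ρ2 ρ₀2≡k∸1))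
      (λ 4≤i _ → transpose-2-3-fixed 4≤i)
      (λ 3≤i i≤ℓ → let (i≢1 , i≢2 , i≢k∸1 , i≢k) = interior 3≤i i≤ℓ
                   in trans (cong (transpose 1 k) (transpose-other 2 (k ∸ 1) i≢2 i≢k∸1))
                            (transpose-other 1 k i≢1 i≢k))

  ea-avoiding-1 : ∀ {a b} → a ∈[1, k ] → b ∈[1, k ] → a ≢ 1 → b ≢ 1 → a ≢ b → Ea a b
  ea-avoiding-1 a∈ b∈ a≢1 b≢1 a≢b =
    let (σ , (σ-perm , σ-inj) , σ1≡1 , σk≡a , σk∸1≡b) =
          relabel₂ k∈ k∸1∈ a∈ b∈ k≢1 k∸1≢1 a≢1 b≢1 k≢k∸1 a≢b
    in σ ∘ transpose 2 3 , σ ∘ ρ₀ ,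
       ∘-isPerm σ-perm (transpose-isPerm 2∈ 3∈) ,
       ∘-isPerm σ-perm (∘-isPerm (transpose-isPerm 1∈ 2∈)
                                 (∘-isPerm (transpose-isPerm 1∈ k∸1∈) (transpose-isPerm 1∈ k∈))) ,
       σ1≡1 , trans (cong σ ρ₀1≡k) σk≡a , trans (cong σ ρ₀k≡k∸1) σk∸1≡b , cong σ (sym ρ₀k∸1≡2) ,
       relabel-separated (transpose 2 3) ρ₀ σ-inj separated ,
       λ σk≡σρ₀k → k≢k∸1 (trans (sym t23k≡k) (trans (σ-inj σk≡σρ₀k) ρ₀k≡k∸1))
    where
    ρ₀ : ℕ → ℕ
    ρ₀ = transpose 1 2 ∘ transpose 1 (k ∸ 1) ∘ transpose 1 k
    ρ₀1≡k : ρ₀ 1 ≡ k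
    ρ₀1≡k = trans (cong (transpose 1 2 ∘ transpose 1 (k ∸ 1)) (transpose-left 1 k))
              (trans (cong (transpose 1 2) (transpose-other 1 (k ∸ 1) k≢1 k≢k∸1))
                     (transpose-other 1 2 k≢1 k≢2))
    ρ₀2≡1 : ρ₀ 2 ≡ 1
    ρ₀2≡1 = trans (cong (transpose 1 2 ∘ transpose 1 (k ∸ 1)) (transpose-other 1 k (λ ()) (<⇒≢ 2<k)))
                  (cong (transpose 1 2) (transpose-other 1 (k ∸ 1) (λ ()) (≢-sym k∸1≢2)))
    ρ₀k≡k∸1 : ρ₀ k ≡ k ∸ 1
    ρ₀k≡k∸1 = trans (cong (transpose 1 2 ∘ transpose 1 (k ∸ 1)) (transpose-right 1 k))
                    (trans (cong (transpose 1 2) (transpose-left 1 (k ∸ 1)))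
                           (transpose-other 1 2 k∸1≢1 k∸1≢2))
    ρ₀k∸1≡2 : ρ₀ (k ∸ 1) ≡ 2
    ρ₀k∸1≡2 = trans (cong (transpose 1 2 ∘ transpose 1 (k ∸ 1)) (transpose-other 1 k k∸1≢1 (≢-sym k≢k∸1)))
                    (cong (transpose 1 2) (transpose-right 1 (k ∸ 1)))
    separated : Separated (_< ℓ) (transpose 2 3) ρ₀
    separated = separated-fixed id
      (λ 3≡ρ1 → <⇒≢ 4≤k (trans 3≡ρ1 ρ₀1≡k))
      (λ 2≡ρ2 → (2 ≢ 1 ∋ λ ()) (trans 2≡ρ2 ρ₀2≡1))
      (λ _ 4≡ρ2 → (4 ≢ 1 ∋ λ ()) (trans 4≡ρ2 ρ₀2≡1))
      (λ 4≤i _ → transpose-2-3-fixed 4≤i)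
      (λ 3≤i i≤ℓ → let (i≢1 , i≢2 , i≢k∸1 , i≢k) = interior 3≤i i≤ℓ
                   in trans (cong (transpose 1 2 ∘ transpose 1 (k ∸ 1)) (transpose-other 1 k i≢1 i≢k))
                            (trans (cong (transpose 1 2) (transpose-other 1 (k ∸ 1) i≢1 i≢k∸1))
                                   (transpose-other 1 2 i≢1 i≢2)))

  ea : ∀ {a b} → a ∈[1, k ] → b ∈[1, k ] → a ≢ b → Ea a b
  ea {a} {b} a∈ b∈ a≢b with a ≟ 1 | b ≟ 1
  ... | yes refl | yes refl = contradiction refl a≢b
  ... | yes refl | no b≢1   = ea-starting-at-1 b∈ b≢1
  ... | no a≢1   | yes refl = ea-ending-at-1 a∈ a≢1
  ... | no a≢1   | no b≢1   = ea-avoiding-1 a∈ b∈ a≢1 b≢1 a≢b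

  Eb1 : ℕ → Set
  Eb1 c = ∃₂ λ π ρ → IsPerm k π × IsPerm k ρ × π 1 ≡ 1 × π k ≡ c × ρ 1 ≡ 1 × π 3 ≡ ρ k ×
                     Separated (_< ℓ) π ρ

  eb1 : ∀ {c} → c ∈[1, k ] → c ≢ 1 → Eb1 c
  eb1 c∈ c≢1 =
    let (σ , (σ-perm , σ-inj) , σ1≡1 , σk≡c) = relabel₁ k∈ c∈ k≢1 c≢1
    in σ ∘ transpose 2 3 , σ ∘ transpose 2 k ,
       ∘-isPerm σ-perm (transpose-isPerm 2∈ 3∈) , ∘-isPerm σ-perm (transpose-isPerm 2∈ k∈) ,
       σ1≡1 , trans (cong σ t23k≡k) σk≡c , trans (cong σ (transpose-other 2 k (λ ()) (<⇒≢ 1<k))) σ1≡1 ,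
       cong σ (sym (transpose-right 2 k)) ,
       relabel-separated (transpose 2 3) (transpose 2 k) σ-inj
         (transpose-23-2k-separated 2<k id (λ 2<ℓ → <-trans (n<1+n 4) (5<k 2<ℓ))
                                            (λ i≤ℓ → <-trans (below-k∸1 i≤ℓ) k∸1<k))

  Eb2 : ℕ → Set
  Eb2 c = ∃₂ λ π ρ → IsPerm k π × IsPerm k ρ × π 1 ≡ 1 × π k ≡ c × ρ 1 ≡ 1 ×
                     Separated (_< ℓ) π ρ × π k ≢ ρ k

  eb2 : ∀ {c} → c ∈[1, k ] → c ≢ 1 → Eb2 c
  eb2 c∈ c≢1 =
    let (σ , (σ-perm , σ-inj) , σ1≡1 , σk≡c) = relabel₁ k∈ c∈ k≢1 c≢1
    in σ , σ ∘ ρ₀ , σ-perm , ∘-isPerm σ-perm (transpose-isPerm k∸1∈ k∈) ,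
       σ1≡1 , σk≡c , trans (cong σ ρ₀1≡1) σ1≡1 ,
       relabel-separated id ρ₀ σ-inj separated ,
       λ σk≡σρ₀k → k≢k∸1 (trans (σ-inj σk≡σρ₀k) (transpose-right (k ∸ 1) k))
    where
    ρ₀ : ℕ → ℕ
    ρ₀ = transpose (k ∸ 1) k
    ρ₀1≡1 : ρ₀ 1 ≡ 1
    ρ₀1≡1 = transpose-other (k ∸ 1) k (≢-sym k∸1≢1) (≢-sym k≢1)
    ρ₀2≡2 : ρ₀ 2 ≡ 2
    ρ₀2≡2 = transpose-other (k ∸ 1) k (≢-sym k∸1≢2) (≢-sym k≢2)
    separated : Separated (_< ℓ) id ρ₀
    separated = separated-fixed id
      (λ 2≡ρ1 → (2 ≢ 1 ∋ λ ()) (trans 2≡ρ1 ρ₀1≡1))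
      (λ 3≡ρ2 → (3 ≢ 2 ∋ λ ()) (trans 3≡ρ2 ρ₀2≡2))
      (λ _ 4≡ρ2 → (4 ≢ 2 ∋ λ ()) (trans 4≡ρ2 ρ₀2≡2))
      (λ _ _ → refl)
      (λ 3≤i i≤ℓ → let (_ , _ , i≢k∸1 , i≢k) = interior 3≤i i≤ℓ in transpose-other (k ∸ 1) k i≢k∸1 i≢k)

lemma23 :
  -- odd case: k = 2ℓ+1 ≥ 3
  (∀ k ℓ a b c → 3 ≤ k → k ≡ 2 * ℓ + 1 →
    1 ≤ a → a ≤ k → 1 ≤ b → b ≤ k → 1 ≤ c → c ≤ k → a ≢ b → c ≢ 1 →
    -- (oa)
    (∃₂ λ π ρ → IsPerm k π × IsPerm k ρ ×
      π 1 ≡ 1 × ρ 1 ≡ a × ρ k ≡ b ×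
      (∀ j → 1 ≤ j → j ≤ ℓ → π (2 * j) ≢ ρ j × π (2 * j + 1) ≢ ρ (j + 1)))
    ×
    -- (ob1)
    (∃₂ λ π ρ → IsPerm k π × IsPerm k ρ ×
      π 1 ≡ 1 × π k ≡ c × ρ 1 ≡ 1 ×
      (∀ j → 1 ≤ j → j < ℓ → π (2 * j) ≢ ρ j × π (2 * j + 1) ≢ ρ (j + 1)) ×
      π (k ∸ 1) ≢ ρ k)
    ×
    -- (ob2)
    (∃₂ λ π ρ → IsPerm k π × IsPerm k ρ ×
      π 1 ≡ 1 × π 2 ≡ c × ρ 1 ≡ 1 × π 3 ≡ ρ k ×
      (∀ j → 1 ≤ j → j ≤ ℓ → π (2 * j) ≢ ρ j × π (2 * j + 1) ≢ ρ (j + 1))))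
  ×
  -- even case: k = 2ℓ ≥ 4
  (∀ k ℓ a b c → 4 ≤ k → k ≡ 2 * ℓ →
    1 ≤ a → a ≤ k → 1 ≤ b → b ≤ k → 1 ≤ c → c ≤ k → a ≢ b → c ≢ 1 →
    -- (ea)
    (∃₂ λ π ρ → IsPerm k π × IsPerm k ρ ×
      π 1 ≡ 1 × ρ 1 ≡ a × ρ k ≡ b × π 3 ≡ ρ (k ∸ 1) ×
      (∀ j → 1 ≤ j → j < ℓ → π (2 * j) ≢ ρ j × π (2 * j + 1) ≢ ρ (j + 1)) ×
      π k ≢ ρ k)
    ×
    -- (eb1)
    (∃₂ λ π ρ → IsPerm k π × IsPerm k ρ ×
      π 1 ≡ 1 × π k ≡ c × ρ 1 ≡ 1 × π 3 ≡ ρ k ×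
      (∀ j → 1 ≤ j → j < ℓ → π (2 * j) ≢ ρ j × π (2 * j + 1) ≢ ρ (j + 1)))
    ×
    -- (eb2)
    (∃₂ λ π ρ → IsPerm k π × IsPerm k ρ ×
      π 1 ≡ 1 × π k ≡ c × ρ 1 ≡ 1 ×
      (∀ j → 1 ≤ j → j < ℓ → π (2 * j) ≢ ρ j × π (2 * j + 1) ≢ ρ (j + 1)) ×
      π k ≢ ρ k))
lemma23 =
  (λ k ℓ a b c 3≤k k≡2*ℓ+1 1≤a a≤k 1≤b b≤k 1≤c c≤k a≢b c≢1 →
     let open OddCase k ℓ 3≤k k≡2*ℓ+1
     in oa (1≤a , a≤k) (1≤b , b≤k) a≢b , ob1 (1≤c , c≤k) c≢1 , ob2 (1≤c , c≤k) c≢1) ,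
  (λ k ℓ a b c 4≤k k≡2*ℓ 1≤a a≤k 1≤b b≤k 1≤c c≤k a≢b c≢1 →
     let open EvenCase k ℓ 4≤k k≡2*ℓ
     in ea (1≤a , a≤k) (1≤b , b≤k) a≢b , eb1 (1≤c , c≤k) c≢1 , eb2 (1≤c , c≤k) c≢1)
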